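{- Let $c\ge1$ be a constant and for $n\ge0$ let $S_n=[-\lceil cn\rceil,\lceil cn\rceil]^2$ (grid graph), $\underline{S}=(S_n)_{n\ge0}$. Then there is a sequence of activated vertices $\underline{v}$ such that the burning density exists and $\delta(\underline{S},\underline{v})=1$.
   Context: For an integer $a\ge0$, $[-a,a]^2$ denotes the graph on vertex set $[-a,a]^2\subset\mathbb{Z}^2$ in which two vertices are adjacent iff their $L_1$-distance is $1$. Burning process: let $\underline{G}=(G_0,G_1,\dots)$ be graphs with $G_{n-1}$ an induced subgraph of $G_n$ for all $n\ge1$. A sequence of activated vertices is $\underline{v}=(v_n)_{n\ge0}$ with $v_n\in V(G_n)\cup\{\bullet\}$ ($\bullet$ means no vertex is activated). Burning sets: $B_0=\{v_0\}$ (empty if $v_0=\bullet$), and $B_{n+1}=N_{G_{n+1}}[B_n]$ if $v_{n+1}=\bullet$, and $B_{n+1}=N_{G_{n+1}}[B_n]\cup\{v_{n+1}\}$ otherwise, where $N_G[X]$ is the closed neighbourhood of $X$ in $G$. The burning density is $\delta(\underline{G},\underline{v})=\lim_{n\to\infty}|B_n|/|V(G_n)|$ when the limit exists. -}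

module Defs where

open import Data.Bool using (Bool; true; false; _∧_; _∨_)
open import Data.Nat as ℕ using (ℕ; zero; suc)
open import Data.Integer as ℤ using (ℤ; +_)
open import Data.Rational as ℚ using (ℚ; _/_; 0ℚ; 1ℚ)
open import Data.Product using (_×_; _,_; Σ; ∃; ∃-syntax)
open import Data.Sum using (_⊎_)
open import Data.Maybe using (Maybe; just; nothing)
open import Data.List using (List; []; _∷_; concatMap; map; upTo)
open import Data.Empty using (⊥)
open import Relation.Nullary using (¬_)
open import Relation.Nullary.Decidable using (⌊_⌋)
open import Relation.Binary.PropositionalEquality using (_≡_)

-- Real numbers as (two-sided, located) Dedekind cuts on ℚ.
-- L q  means  q < c ,   U q  means  c < q.

record ℝ : Set₁ where
  field
    L U       : ℚ → Set
    L-inhab   : ∃[ q ] L q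
    U-inhab   : ∃[ q ] U q
    L-lower   : ∀ {p q} → p ℚ.< q → L q → L p
    L-round   : ∀ {q} → L q → ∃[ r ] (q ℚ.< r × L r)
    U-upper   : ∀ {p q} → p ℚ.< q → U p → U q
    U-round   : ∀ {q} → U q → ∃[ r ] (r ℚ.< q × U r)
    disjoint  : ∀ {q} → L q → U q → ⊥
    located   : ∀ {p q} → p ℚ.< q → L p ⊎ U q

open ℝ public

-- c ≥ 1  (i.e. not c < 1)
OneLeq : ℝ → Set
OneLeq c = ¬ U c 1ℚ

-- a n = ⌈ c · n ⌉ for every n, i.e. a 0 = 0 and, for n ≥ 1,
--   a n - 1 < c · n ≤ a n ,  i.e.  (a n - 1)/n < c  and  ¬ (a n / n < c).
IsCeilMul : ℝ → (ℕ → ℕ) → Set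
IsCeilMul c a =
  (a 0 ≡ 0) ×
  (∀ k → L c ((+ a (suc k) ℤ.- + 1) / suc k) × ¬ L c ((+ a (suc k)) / suc k))

-- The grid graph [-r, r]^2 on ℤ², adjacency = L1 distance 1.

Point : Set
Point = ℤ × ℤ

inRange : ℕ → ℤ → Bool
inRange r x = ⌊ ℤ.- (+ r) ℤ.≤? x ⌋ ∧ ⌊ x ℤ.≤? + r ⌋

inBox : ℕ → Point → Bool
inBox r (x , y) = inRange r x ∧ inRange r y

range : ℕ → List ℤ
range r = map (λ i → + i ℤ.- + r) (upTo (suc (2 ℕ.* r)))

boxPoints : ℕ → List Point
boxPoints r = concatMap (λ x → map (λ y → (x , y)) (range r)) (range r)

boxSize : ℕ → ℕ
boxSize r = suc (2 ℕ.* r) ℕ.* suc (2 ℕ.* r)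

_==ᴾ_ : Point → Point → Bool
(x , y) ==ᴾ (x' , y') = ⌊ x ℤ.≟ x' ⌋ ∧ ⌊ y ℤ.≟ y' ⌋

isActivated : Maybe Point → Point → Bool
isActivated nothing  p = false
isActivated (just q) p = q ==ᴾ p

-- Burning process on the sequence of grids G_n = [-a n, a n]^2
-- with activation sequence v (nothing = •).
-- burning a v n p = true  iff  p ∈ B_n.

burning : (ℕ → ℕ) → (ℕ → Maybe Point) → ℕ → Point → Bool
burning a v zero    p = isActivated (v zero) p
burning a v (suc n) (x , y) =
  (inBox r (x , y) ∧
     (Bn (x , y)
      ∨ nb (x ℤ.+ + 1 , y) ∨ nb (x ℤ.- + 1 , y)
      ∨ nb (x , y ℤ.+ + 1) ∨ nb (x , y ℤ.- + 1)))
  ∨ isActivated (v (suc n)) (x , y)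
  where
    r = a (suc n)
    Bn = burning a v n
    nb : Point → Bool
    nb q = inBox r q ∧ Bn q

countTrue : {A : Set} → (A → Bool) → List A → ℕ
countTrue f []       = 0
countTrue f (x ∷ xs) with f x
... | true  = suc (countTrue f xs)
... | false = countTrue f xs

burnedCount : (ℕ → ℕ) → (ℕ → Maybe Point) → ℕ → ℕ
burnedCount a v n = countTrue (burning a v n) (boxPoints (a n))

burnRatio : (ℕ → ℕ) → (ℕ → Maybe Point) → ℕ → ℚ
burnRatio a v n = (+ burnedCount a v n) / boxSize (a n)

ValidActivation : (ℕ → ℕ) → (ℕ → Maybe Point) → Set
ValidActivation a v = ∀ n p → v n ≡ just p → inBox (a n) p ≡ true

DensityOne : (ℕ → ℕ) → (ℕ → Maybe Point) → Set
DensityOne a v =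
  ∀ (ε : ℚ) → 0ℚ ℚ.< ε →
    ∃[ N ] ∀ n → N ℕ.≤ n → ℚ.∣ burnRatio a v n ℚ.- 1ℚ ∣ ℚ.< ε

module Submission where

-- Write a n = ⌈cn⌉.  This sequence grows by at least 1 and at most K per step for some
-- K ≥ c (SlopeBounds).  Since grids grow by at least one per step, a vertex activated at
-- time i inside G_i burns the whole L1-ball of radius d around it at time i + d
-- (Fire.ball-burns).  Time is cut into phases: phase k starts at 4k³ and lasts
-- 12k² + 12k + 4 steps.  During phase k we activate, one per step, the (2k+1)² points of
-- a square lattice of spacing 1 + 8Kk² spanning [-a, a]² with a ≥ a(4k³) (Strategy).  Every
-- vertex of G at the start of phase k is then within distance 2·(1 + 8Kk²) of an activated
-- point, and this distance is covered within the next 2K phases; so at any time n of phase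
-- k, the whole grid G_{4(k-2K-1)³} is burning (Covering.core-burnt).  Meanwhile the grid
-- grew by only O(K²k²) while its radius is at least n ≥ 4k³, so the unburnt fraction is
-- O(1/k) (Covering.deficit-small), which gives density 1 (density-from-deficit).

open import Defs
open import Data.Nat using (ℕ)
open import Data.Product using (_×_; ∃-syntax)
open import Data.Maybe using (Maybe)
open import Data.Nat as N using (zero; suc; _+_; _*_; _∸_; z≤n; s≤s)
import Data.Nat.Properties as NP
open import Data.Nat.DivMod as DM using (_/_; _%_)
open import Data.Nat.Divisibility using (divides-refl)
open import Data.Nat.Coprimality using (Coprime)
open import Data.Nat.Tactic.RingSolver using (solve-∀)
open import Data.Integer as Z using (ℤ; +_; -[1+_]; +[1+_]; +0; +<+; +≤+; -≤+)
import Data.Integer.Properties as ZP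
import Data.Integer.Tactic.RingSolver as ZR
open import Data.Rational as Q using (mkℚ)
import Data.Rational.Properties as QP
import Data.Rational.Unnormalised as U
import Data.Rational.Unnormalised.Properties as UP
open import Data.Bool using (Bool; true; false; _∧_; _∨_)
import Data.Bool.Properties as BP
open import Data.Maybe using (just; nothing)
open import Data.List using (List; []; _∷_; _++_; map; concatMap; upTo; applyUpTo)
import Data.List.Properties as LP
open import Data.Product using (Σ; _,_; proj₁; proj₂)
open import Data.Sum using (inj₁; inj₂)
open import Data.Empty using (⊥-elim)
open import Relation.Nullary using (¬_; yes; no; contradiction)
open import Relation.Nullary.Decidable using (Dec; ⌊_⌋; dec-true; isYes≗does)
open import Relation.Binary using (tri<; tri≈; tri>)
open import Relation.Binary.PropositionalEquality
  using (_≡_; refl; sym; trans; cong; cong₂; subst; subst₂; module ≡-Reasoning)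

/-toℚᵘ : ∀ (i : ℤ) m → Q.toℚᵘ (i Q./ suc m) U.≃ U.mkℚᵘ i m
/-toℚᵘ i m = QP.toℚᵘ-fromℚᵘ (U.mkℚᵘ i m)

/-<⇒cross : ∀ (i j : ℤ) m l → (i Q./ suc m) Q.< (j Q./ suc l) →
            i Z.* + suc l Z.< j Z.* + suc m
/-<⇒cross i j m l h
  with UP.<-respˡ-≃ (/-toℚᵘ i m) (UP.<-respʳ-≃ (/-toℚᵘ j l) (QP.toℚᵘ-mono-< h))
... | U.*<* p = p

cross⇒/-< : ∀ (i j : ℤ) m l → i Z.* + suc l Z.< j Z.* + suc m →
            (i Q./ suc m) Q.< (j Q./ suc l)
cross⇒/-< i j m l h = QP.toℚᵘ-cancel-<
  (UP.<-respˡ-≃ (UP.≃-sym (/-toℚᵘ i m)) (UP.<-respʳ-≃ (UP.≃-sym (/-toℚᵘ j l)) (U.*<* h)))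

+*+<⇒*< : ∀ {a b c d} → + a Z.* + b Z.< + c Z.* + d → a * b N.< c * d
+*+<⇒*< {a} {b} {c} {d} h rewrite sym (ZP.pos-* a b) | sym (ZP.pos-* c d) with h
... | +<+ p = p

*<⇒+*+< : ∀ {a b c d} → a * b N.< c * d → + a Z.* + b Z.< + c Z.* + d
*<⇒+*+< {a} {b} {c} {d} h rewrite sym (ZP.pos-* a b) | sym (ZP.pos-* c d) = +<+ h

below-cut< : (c : ℝ) → ∀ {x y} → L c x → ¬ L c y → x Q.< y
below-cut< c {x} {y} lx ¬ly with QP.<-cmp x y
... | tri< p _ _ = p
... | tri≈ _ e _ = ⊥-elim (¬ly (subst (L c) e lx))
... | tri> _ _ p = ⊥-elim (¬ly (L-lower c p lx))

below-above< : (c : ℝ) → ∀ {x y} → L c x → U c y → x Q.< y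
below-above< c {x} {y} lx uy with QP.<-cmp x y
... | tri< p _ _ = p
... | tri≈ _ e _ = ⊥-elim (disjoint c (subst (L c) e lx) uy)
... | tri> _ _ p = ⊥-elim (disjoint c (L-lower c p lx) uy)

record SlopeBounds (a : ℕ → ℕ) : Set where
  field
    K         : ℕ
    1≤K       : 1 N.≤ K
    n≤a       : ∀ n → n N.≤ a n
    a≤K*      : ∀ n → a n N.≤ K * n
    grows     : ∀ i d → a i + d N.≤ a (i + d)
    lipschitz : ∀ i d → a (i + d) N.≤ a i + K * d

-- From  ai·(i+d) < an·i + (i+d)  (i.e. (ai-1)/i < an/(i+d)) and  an ≥ i+d,
-- the sequence gained at least d between i and i+d.
gain-from-cross : ∀ ai an i d → i + d N.≤ an → ai * (i + d) N.< an * i + (i + d) → ai + d N.≤ an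
gain-from-cross ai an i d i+d≤an h with ai + d N.≤? an
... | yes p = p
... | no ¬p = contradiction h (NP.≤⇒≯ an*i+i+d≤ai*[i+d])
  where
    e : ℕ
    e = an ∸ (i + d)
    an≡ : an ≡ (i + d) + e
    an≡ = sym (NP.m+[n∸m]≡n i+d≤an)
    suc-an≤ai+d : suc an N.≤ ai + d
    suc-an≤ai+d = NP.≰⇒> ¬p
    reassoc : ∀ i d e → suc ((i + d) + e) ≡ d + suc (i + e)
    reassoc = solve-∀
    i+e<ai : suc (i + e) N.≤ ai
    i+e<ai = NP.+-cancelˡ-≤ d _ _
      (subst₂ N._≤_ (trans (cong suc an≡) (reassoc i d e)) (NP.+-comm ai d) suc-an≤ai+d)
    expand : ∀ i d e → ((i + d) + e) * i + (i + d) + e * d ≡ (1 + (i + e)) * (i + d)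
    expand = solve-∀
    an*i+i+d≤ai*[i+d] : an * i + (i + d) N.≤ ai * (i + d)
    an*i+i+d≤ai*[i+d] = NP.≤-trans
      (subst (λ z → z * i + (i + d) N.≤ ((i + d) + e) * i + (i + d) + e * d) (sym an≡) (NP.m≤m+n _ _))
      (NP.≤-trans (NP.≤-reflexive (expand i d e)) (NP.*-monoˡ-≤ (i + d) i+e<ai))

-- From  an·i < ai·(i+d) + i  (i.e. (an-1)/(i+d) < ai/i) and  ai ≤ K i,
-- the sequence gained at most K d between i and i+d.
gain-bounded : ∀ ai an i d K → ai N.≤ K * i → an * i N.< ai * (i + d) + i → an N.≤ ai + K * d
gain-bounded ai an i d K ai≤Ki h with an N.≤? ai + K * d
... | yes p = p
... | no ¬p = contradiction h (NP.≤⇒≯ ai*[i+d]+i≤an*i)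
  where
    eq₁ : ∀ ai d i → ai * (i + d) + i ≡ ai * i + d * ai + i
    eq₁ = solve-∀
    eq₂ : ∀ ai d i K → ai * i + d * (K * i) + i ≡ i + (ai + K * d) * i
    eq₂ = solve-∀
    ai*[i+d]+i≤an*i : ai * (i + d) + i N.≤ an * i
    ai*[i+d]+i≤an*i = NP.≤-trans (NP.≤-reflexive (eq₁ ai d i))
      (NP.≤-trans (NP.+-monoˡ-≤ i (NP.+-monoʳ-≤ (ai * i) (NP.*-monoʳ-≤ d ai≤Ki)))
      (NP.≤-trans (NP.≤-reflexive (eq₂ ai d i K)) (NP.*-monoˡ-≤ i (NP.≰⇒> ¬p))))

module CeilingFacts (c : ℝ) (1≤c : OneLeq c) (a : ℕ → ℕ) (ceil : IsCeilMul c a) where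

  -- (a i - 1)/i < c ≤ a j / j, cross-multiplied (with i = m+1, j = l+1).
  cross-ceil : ∀ m l → a (suc m) * suc l N.< a (suc l) * suc m + suc l
  cross-ceil m l = cross-minus-one (a (suc m)) (below-cut< c (proj₁ (proj₂ ceil m)) (proj₂ (proj₂ ceil l)))
    where
      cross-minus-one : ∀ ai → ((+ ai Z.- + 1) Q./ suc m) Q.< ((+ a (suc l)) Q./ suc l) →
                        ai * suc l N.< a (suc l) * suc m + suc l
      cross-minus-one zero h = NP.<-≤-trans (s≤s z≤n) (NP.m≤n+m (suc l) _)
      cross-minus-one (suc ai) h = subst (suc l + ai * suc l N.<_) (NP.+-comm (suc l) _)
        (NP.+-monoʳ-< (suc l) (+*+<⇒*< {ai} {suc l} {a (suc l)} {suc m} (/-<⇒cross (+ ai) (+ a (suc l)) m l h)))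

  ceil-≥ : ∀ m → suc m N.≤ a (suc m)
  ceil-≥ m with suc m N.≤? a (suc m)
  ... | yes p = p
  ... | no ¬p with located c a/m<1
    where
      a*1<1*m : a (suc m) * 1 N.< 1 * suc m
      a*1<1*m = subst₂ N._<_ (sym (NP.*-identityʳ _)) (sym (NP.*-identityˡ _)) (NP.≰⇒> ¬p)
      a/m<1 : ((+ a (suc m)) Q./ suc m) Q.< Q.1ℚ
      a/m<1 = cross⇒/-< (+ a (suc m)) (+ 1) m 0 (*<⇒+*+< {a (suc m)} {1} {1} {suc m} a*1<1*m)
  ... | inj₁ below = ⊥-elim (proj₂ (proj₂ ceil m) below)
  ... | inj₂ above = ⊥-elim (1≤c above)

  -- An upper rational bound K/(D+1) > c gives a n ≤ K n.
  ceil-≤ : Σ ℕ λ K → ∀ m → a (suc m) N.≤ K * suc m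
  ceil-≤ with U-inhab c
  ... | (q , c<q) = from-bound q c<q (1<q q c<q)
    where
      1<q : ∀ q → U c q → Q.1ℚ Q.< q
      1<q q c<q with QP.<-cmp q Q.1ℚ
      ... | tri< p _ _ = ⊥-elim (1≤c (U-upper c p c<q))
      ... | tri≈ _ e _ = ⊥-elim (1≤c (subst (U c) e c<q))
      ... | tri> _ _ p = p
      from-bound : ∀ q → U c q → Q.1ℚ Q.< q → Σ ℕ λ K → ∀ m → a (suc m) N.≤ K * suc m
      from-bound (mkℚ -[1+ _ ] _ _) _ (Q.*<* ())
      from-bound (mkℚ (+ K) D _) c<q _ = K , λ m → numerator-bound (a (suc m)) m (cross m)
        where
          cross : ∀ m → (+ a (suc m) Z.- + 1) Z.* + suc D Z.< + K Z.* + suc m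
          cross m with UP.<-respˡ-≃ (/-toℚᵘ (+ a (suc m) Z.- + 1) m)
                         (QP.toℚᵘ-mono-< (below-above< c (proj₁ (proj₂ ceil m)) c<q))
          ... | U.*<* p = p
          numerator-bound : ∀ x m → (+ x Z.- + 1) Z.* + suc D Z.< + K Z.* + suc m → x N.≤ K * suc m
          numerator-bound zero m _ = z≤n
          numerator-bound (suc x) m p =
            NP.≤-<-trans (NP.m≤m*n x (suc D)) (+*+<⇒*< {x} {suc D} {K} {suc m} p)

ceiling-slopes : (c : ℝ) → OneLeq c → (a : ℕ → ℕ) → IsCeilMul c a → SlopeBounds a
ceiling-slopes c 1≤c a ceil = record
  { K = K ; 1≤K = 1≤K ; n≤a = n≤a ; a≤K* = a≤K*
  ; grows = grows ; lipschitz = lipschitz }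
  where
    open CeilingFacts c 1≤c a ceil
    K : ℕ
    K = proj₁ ceil-≤
    a-zero : a 0 ≡ 0
    a-zero = proj₁ ceil
    n≤a : ∀ n → n N.≤ a n
    n≤a zero = z≤n
    n≤a (suc m) = ceil-≥ m
    a≤K* : ∀ n → a n N.≤ K * n
    a≤K* zero = NP.≤-reflexive (trans a-zero (sym (NP.*-zeroʳ K)))
    a≤K* (suc m) = proj₂ ceil-≤ m
    1≤K : 1 N.≤ K
    1≤K = NP.≤-trans (n≤a 1) (NP.≤-trans (a≤K* 1) (NP.≤-reflexive (NP.*-identityʳ K)))
    grows : ∀ i d → a i + d N.≤ a (i + d)
    grows zero d rewrite a-zero = n≤a d
    grows (suc m) d = gain-from-cross (a (suc m)) (a (suc m + d)) (suc m) d (n≤a (suc m + d)) (cross-ceil m (m + d))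
    lipschitz : ∀ i d → a (i + d) N.≤ a i + K * d
    lipschitz zero d rewrite a-zero = a≤K* d
    lipschitz (suc m) d = gain-bounded (a (suc m)) (a (suc m + d)) (suc m) d K (a≤K* (suc m)) (cross-ceil (m + d) m)

InBox : ℕ → Point → Set
InBox r (x , y) = Z.∣ x ∣ N.≤ r × Z.∣ y ∣ N.≤ r

⌊⌋-true : ∀ {A : Set} (A? : Dec A) → A → ⌊ A? ⌋ ≡ true
⌊⌋-true A? a = trans (isYes≗does A?) (dec-true A? a)

inRange-intro : ∀ r x → Z.∣ x ∣ N.≤ r → inRange r x ≡ true
inRange-intro r x h = cong₂ _∧_ (⌊⌋-true (Z.- (+ r) Z.≤? x) (lower r x h)) (⌊⌋-true (x Z.≤? + r) (upper r x h))
  where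
    lower : ∀ r x → Z.∣ x ∣ N.≤ r → Z.- (+ r) Z.≤ x
    lower zero    (+ n)     _       = +≤+ z≤n
    lower (suc r) (+ n)     _       = -≤+
    lower (suc r) -[1+ n ] (s≤s h) = Z.-≤- h
    upper : ∀ r x → Z.∣ x ∣ N.≤ r → x Z.≤ + r
    upper r (+ n)     h = +≤+ h
    upper r -[1+ n ] _ = -≤+

inBox-intro : ∀ r p → InBox r p → inBox r p ≡ true
inBox-intro r (x , y) (hx , hy) = cong₂ _∧_ (inRange-intro r x hx) (inRange-intro r y hy)

data Near : Point → Point → Set where
  here  : ∀ {p} → Near p p
  east  : ∀ {x y} → Near (x , y) (x Z.+ + 1 , y)
  west  : ∀ {x y} → Near (x , y) (x Z.- + 1 , y)
  north : ∀ {x y} → Near (x , y) (x , y Z.+ + 1)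
  south : ∀ {x y} → Near (x , y) (x , y Z.- + 1)

dist₁ : Point → Point → ℕ
dist₁ (px , py) (x , y) = Z.∣ x Z.- px ∣ + Z.∣ y Z.- py ∣

∣shift-down∣ : ∀ z pz k → z Z.- pz ≡ +[1+ k ] → Z.∣ (z Z.- + 1) Z.- pz ∣ ≡ k
∣shift-down∣ z pz k e = cong Z.∣_∣ (trans (reorder z pz) (cong (Z._- + 1) e))
  where
    reorder : ∀ z pz → (z Z.- + 1) Z.- pz ≡ (z Z.- pz) Z.- + 1
    reorder = ZR.solve-∀

∣shift-up∣ : ∀ z pz k → z Z.- pz ≡ -[1+ k ] → Z.∣ (z Z.+ + 1) Z.- pz ∣ ≡ k
∣shift-up∣ z pz k e = trans (cong Z.∣_∣ (trans (reorder z pz) (cong (Z._+ + 1) e))) (∣-[1+k]+1∣ k)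
  where
    reorder : ∀ z pz → (z Z.+ + 1) Z.- pz ≡ (z Z.- pz) Z.+ + 1
    reorder = ZR.solve-∀
    ∣-[1+k]+1∣ : ∀ k → Z.∣ -[1+ k ] Z.+ + 1 ∣ ≡ k
    ∣-[1+k]+1∣ zero    = refl
    ∣-[1+k]+1∣ (suc k) = refl

step-towards : ∀ p q d → dist₁ p q N.≤ suc d → ∃[ q' ] (Near q q' × dist₁ p q' N.≤ d)
step-towards (px , py) (x , y) d h with x Z.- px in ex | y Z.- py in ey
... | +0 | +0 = (x , y) , here , subst (N._≤ d) (cong₂ (λ u w → Z.∣ u ∣ + Z.∣ w ∣) (sym ex) (sym ey)) z≤n
... | +0 | +[1+ k ] = (x , y Z.- + 1) , south ,
  subst (N._≤ d) (cong₂ _+_ (cong Z.∣_∣ (sym ex)) (sym (∣shift-down∣ y py k ey))) (NP.≤-pred h)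
... | +0 | -[1+ k ] = (x , y Z.+ + 1) , north ,
  subst (N._≤ d) (cong₂ _+_ (cong Z.∣_∣ (sym ex)) (sym (∣shift-up∣ y py k ey))) (NP.≤-pred h)
... | +[1+ k ] | dy = (x Z.- + 1 , y) , west ,
  subst (N._≤ d) (cong₂ _+_ (sym (∣shift-down∣ x px k ex)) (cong Z.∣_∣ (sym ey))) (NP.≤-pred h)
... | -[1+ k ] | dy = (x Z.+ + 1 , y) , east ,
  subst (N._≤ d) (cong₂ _+_ (sym (∣shift-up∣ x px k ex)) (cong Z.∣_∣ (sym ey))) (NP.≤-pred h)

∣x∣≤∣px∣+∣x-px∣ : ∀ x px → Z.∣ x ∣ N.≤ Z.∣ px ∣ + Z.∣ x Z.- px ∣
∣x∣≤∣px∣+∣x-px∣ x px = subst (λ z → Z.∣ z ∣ N.≤ Z.∣ px ∣ + Z.∣ x Z.- px ∣) (px+[x-px]≡x x px)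
  (ZP.∣i+j∣≤∣i∣+∣j∣ px (x Z.- px))
  where
    px+[x-px]≡x : ∀ x px → px Z.+ (x Z.- px) ≡ x
    px+[x-px]≡x = ZR.solve-∀

ball-in-grid : ∀ {a : ℕ → ℕ} → (∀ i d → a i + d N.≤ a (i + d)) →
               ∀ i p q d → InBox (a i) p → dist₁ p q N.≤ d → InBox (a (i + d)) q
ball-in-grid {a} grows i (px , py) (x , y) d (hx , hy) h =
  NP.≤-trans (NP.≤-trans (∣x∣≤∣px∣+∣x-px∣ x px) (NP.+-mono-≤ hx (NP.≤-trans (NP.m≤m+n _ _) h))) (grows i d) ,
  NP.≤-trans (NP.≤-trans (∣x∣≤∣px∣+∣x-px∣ y py) (NP.+-mono-≤ hy (NP.≤-trans (NP.m≤n+m _ _) h))) (grows i d)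

-- A boolean disjunction holds if one disjunct does (the other disjunct is given
-- explicitly, since it cannot be inferred through _∨_).
∨-introˡ : ∀ {b} c → b ≡ true → b ∨ c ≡ true
∨-introˡ c refl = refl

∨-introʳ : ∀ b {c} → c ≡ true → b ∨ c ≡ true
∨-introʳ b refl = BP.∨-zeroʳ b

dist₁-zero : ∀ p q → dist₁ p q N.≤ 0 → q ≡ p
dist₁-zero (px , py) (x , y) h = cong₂ _,_ (coordinate x px (NP.m+n≡0⇒m≡0 _ h0)) (coordinate y py (NP.m+n≡0⇒n≡0 _ h0))
  where
    h0 : Z.∣ x Z.- px ∣ + Z.∣ y Z.- py ∣ ≡ 0
    h0 = NP.n≤0⇒n≡0 h
    coordinate : ∀ z pz → Z.∣ z Z.- pz ∣ ≡ 0 → z ≡ pz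
    coordinate z pz e = ZP.i-j≡0⇒i≡j z pz (ZP.∣i∣≡0⇒i≡0 e)

module Fire (a : ℕ → ℕ) (v : ℕ → Maybe Point) where

  B : ℕ → Point → Bool
  B = burning a v

  private
    act : ℕ → Point → Bool
    act n p = isActivated (v (suc n)) p

    nb : ℕ → Point → Bool
    nb n q = inBox (a (suc n)) q ∧ B n q

  spreads : ∀ n {p q} → Near p q → inBox (a (suc n)) p ≡ true → inBox (a (suc n)) q ≡ true →
            B n q ≡ true → B (suc n) p ≡ true
  spreads n here inp _ bq rewrite inp | bq = refl
  spreads n (east {x} {y}) inp inq bq rewrite inp | inq | bq =
    ∨-introˡ (act n (x , y)) (∨-introʳ (B n (x , y)) refl)
  spreads n (west {x} {y}) inp inq bq rewrite inp | inq | bq =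
    ∨-introˡ (act n (x , y)) (∨-introʳ (B n (x , y)) (∨-introʳ (nb n (x Z.+ + 1 , y)) refl))
  spreads n (north {x} {y}) inp inq bq rewrite inp | inq | bq =
    ∨-introˡ (act n (x , y)) (∨-introʳ (B n (x , y)) (∨-introʳ (nb n (x Z.+ + 1 , y))
      (∨-introʳ (nb n (x Z.- + 1 , y)) refl)))
  spreads n (south {x} {y}) inp inq bq rewrite inp | inq | bq =
    ∨-introˡ (act n (x , y)) (∨-introʳ (B n (x , y)) (∨-introʳ (nb n (x Z.+ + 1 , y))
      (∨-introʳ (nb n (x Z.- + 1 , y)) (∨-introʳ (nb n (x , y Z.+ + 1)) refl))))

  ==ᴾ-refl : ∀ p → (p ==ᴾ p) ≡ true
  ==ᴾ-refl (x , y) = cong₂ _∧_ (⌊⌋-true (x Z.≟ x) refl) (⌊⌋-true (y Z.≟ y) refl)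

  activated-burns : ∀ n p → v n ≡ just p → B n p ≡ true
  activated-burns zero    p e rewrite e = ==ᴾ-refl p
  activated-burns (suc n) p e rewrite e | ==ᴾ-refl p = BP.∨-zeroʳ _

  ball-burns : (∀ i d → a i + d N.≤ a (i + d)) →
               ∀ i p → v i ≡ just p → InBox (a i) p → ∀ d q → dist₁ p q N.≤ d → B (i + d) q ≡ true
  ball-burns grows i p vi p∈ zero q h =
    subst₂ (λ n z → B n z ≡ true) (sym (NP.+-identityʳ i)) (sym (dist₁-zero p q h)) (activated-burns i p vi)
  ball-burns grows i p vi p∈ (suc d) q h with step-towards p q d h
  ... | q' , near , h' = subst (λ n → B n q ≡ true) (sym (NP.+-suc i d))
    (spreads (i + d) near (in-grid q h) (in-grid q' (NP.m≤n⇒m≤1+n h')) (ball-burns grows i p vi p∈ d q' h'))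
    where
      in-grid : ∀ z → dist₁ p z N.≤ suc d → inBox (a (suc (i + d))) z ≡ true
      in-grid z hz = inBox-intro _ z
        (subst (λ n → InBox (a n) z) (NP.+-suc i d) (ball-in-grid grows i p z (suc d) p∈ hz))

-- Σ_{i<m} g i, peeling off the first term like applyUpTo does.
sumBelow : (ℕ → ℕ) → ℕ → ℕ
sumBelow g zero    = 0
sumBelow g (suc m) = g 0 + sumBelow (λ i → g (suc i)) m

indicator : Bool → ℕ
indicator true  = 1
indicator false = 0

sumBelow-cong : ∀ {g h : ℕ → ℕ} m → (∀ i → g i ≡ h i) → sumBelow g m ≡ sumBelow h m
sumBelow-cong zero    e = refl
sumBelow-cong (suc m) e = cong₂ _+_ (e 0) (sumBelow-cong m (λ i → e (suc i)))

sumBelow-≤ : ∀ g b m → (∀ i → g i N.≤ b) → sumBelow g m N.≤ m * b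
sumBelow-≤ g b zero    h = z≤n
sumBelow-≤ g b (suc m) h = NP.+-mono-≤ (h 0) (sumBelow-≤ (λ i → g (suc i)) b m (λ i → h (suc i)))

sumBelow-≥ : ∀ g b len → (∀ t → t N.< len → b N.≤ g t) → len * b N.≤ sumBelow g len
sumBelow-≥ g b zero      h = z≤n
sumBelow-≥ g b (suc len) h = NP.+-mono-≤ (h 0 (s≤s z≤n)) (sumBelow-≥ (λ i → g (suc i)) b len (λ t lt → h (suc t) (s≤s lt)))

sumBelow-window : ∀ g lo len m → lo + len N.≤ m → sumBelow (λ t → g (lo + t)) len N.≤ sumBelow g m
sumBelow-window g zero    zero      m       _         = z≤n
sumBelow-window g zero    (suc len) (suc m) (s≤s le) = NP.+-monoʳ-≤ (g 0) (sumBelow-window (λ i → g (suc i)) zero len m le)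
sumBelow-window g (suc lo) len      (suc m) (s≤s le) =
  NP.≤-trans (sumBelow-window (λ i → g (suc i)) lo len m le) (NP.m≤n+m _ (g 0))

countTrue-++ : ∀ {A : Set} (f : A → Bool) xs ys → countTrue f (xs ++ ys) ≡ countTrue f xs + countTrue f ys
countTrue-++ f []       ys = refl
countTrue-++ f (x ∷ xs) ys with f x
... | true  = cong suc (countTrue-++ f xs ys)
... | false = countTrue-++ f xs ys

countTrue-applyUpTo : ∀ {A : Set} (f : A → Bool) h m → countTrue f (applyUpTo h m) ≡ sumBelow (λ i → indicator (f (h i))) m
countTrue-applyUpTo f h zero = refl
countTrue-applyUpTo f h (suc m) with f (h 0)
... | true  = cong suc (countTrue-applyUpTo f (λ i → h (suc i)) m)
... | false = countTrue-applyUpTo f (λ i → h (suc i)) m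

countTrue-concatMap : ∀ {A B : Set} (f : B → Bool) (g : A → List B) h m →
                      countTrue f (concatMap g (applyUpTo h m)) ≡ sumBelow (λ i → countTrue f (g (h i))) m
countTrue-concatMap f g h zero = refl
countTrue-concatMap f g h (suc m) = trans (countTrue-++ f (g (h 0)) _)
  (cong (λ s → countTrue f (g (h 0)) + s) (countTrue-concatMap f g (λ i → h (suc i)) m))

coord : ℕ → ℕ → ℤ
coord r i = + i Z.- + r

gridCount : (Point → Bool) → ℕ → ℕ
gridCount f r = sumBelow (λ i → sumBelow (λ j → indicator (f (coord r i , coord r j))) M) M
  where M = suc (2 * r)

countTrue-boxPoints : ∀ f r → countTrue f (boxPoints r) ≡ gridCount f r
countTrue-boxPoints f r = begin
  countTrue f (concatMap row (map (coord r) (upTo M)))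
    ≡⟨ cong (λ xs → countTrue f (concatMap row xs)) (LP.map-upTo (coord r) M) ⟩
  countTrue f (concatMap row (applyUpTo (coord r) M))
    ≡⟨ countTrue-concatMap f row (coord r) M ⟩
  sumBelow (λ i → countTrue f (row (coord r i))) M
    ≡⟨ sumBelow-cong M (λ i → count-row (coord r i)) ⟩
  gridCount f r ∎
  where
    open ≡-Reasoning
    M : ℕ
    M = suc (2 * r)
    row : ℤ → List Point
    row x = map (λ y → (x , y)) (range r)
    count-row : ∀ x → countTrue f (row x) ≡ sumBelow (λ j → indicator (f (x , coord r j))) M
    count-row x = begin
      countTrue f (map (λ y → (x , y)) (map (coord r) (upTo M)))
        ≡⟨ cong (λ ys → countTrue f (map (λ y → (x , y)) ys)) (LP.map-upTo (coord r) M) ⟩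
      countTrue f (map (λ y → (x , y)) (applyUpTo (coord r) M))
        ≡⟨ cong (countTrue f) (LP.map-applyUpTo (coord r) (λ y → (x , y)) M) ⟩
      countTrue f (applyUpTo (λ j → (x , coord r j)) M)
        ≡⟨ countTrue-applyUpTo f (λ j → (x , coord r j)) M ⟩
      sumBelow (λ j → indicator (f (x , coord r j))) M ∎

indicator≤1 : ∀ b → indicator b N.≤ 1
indicator≤1 true  = NP.≤-refl
indicator≤1 false = z≤n

count-≤-boxSize : ∀ f r → countTrue f (boxPoints r) N.≤ boxSize r
count-≤-boxSize f r = subst (N._≤ boxSize r) (sym (countTrue-boxPoints f r))
  (NP.≤-trans (sumBelow-≤ (λ i → sumBelow (cell i) M) (M * 1) M (λ i → sumBelow-≤ (cell i) 1 M (λ j → indicator≤1 _)))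
              (NP.≤-reflexive (cong (M *_) (NP.*-identityʳ M))))
  where
    M : ℕ
    M = suc (2 * r)
    cell : ℕ → ℕ → ℕ
    cell i j = indicator (f (coord r i , coord r j))

∣coord∣≤ : ∀ r r' t → r' N.≤ r → t N.< suc (2 * r') → Z.∣ coord r ((r ∸ r') + t) ∣ N.≤ r'
∣coord∣≤ r r' t r'≤r t<len =
  subst (λ z → Z.∣ + ((r ∸ r') + t) Z.- + z ∣ N.≤ r') (NP.m∸n+n≡m r'≤r)
    (subst (λ z → Z.∣ z ∣ N.≤ r') (sym shift) (∣t-s∣≤s t r' (subst (t N.≤_) (two* r') (NP.≤-pred t<len))))
  where
    two* : ∀ s → 2 * s ≡ s + s
    two* = solve-∀
    cancel : ∀ (l t s : ℤ) → (l Z.+ t) Z.- (l Z.+ s) ≡ t Z.- s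
    cancel = ZR.solve-∀
    shift : + ((r ∸ r') + t) Z.- + ((r ∸ r') + r') ≡ + t Z.- + r'
    shift rewrite ZP.pos-+ (r ∸ r') t | ZP.pos-+ (r ∸ r') r' = cancel (+ (r ∸ r')) (+ t) (+ r')
    ∣t-s∣≤s : ∀ t s → t N.≤ s + s → Z.∣ + t Z.- + s ∣ N.≤ s
    ∣t-s∣≤s t s t≤2s with t N.≤? s
    ... | yes t≤s rewrite ZP.m-n≡m⊖n t s | ZP.⊖-≤ t≤s | ZP.∣-i∣≡∣i∣ (+ (s ∸ t)) = NP.m∸n≤m s t
    ... | no t≰s rewrite ZP.m-n≡m⊖n t s | ZP.⊖-≥ (NP.≰⇒≥ t≰s) =
      NP.≤-trans (NP.∸-monoˡ-≤ s t≤2s) (NP.≤-reflexive (NP.m+n∸n≡m s s))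

count-≥-inner-box : ∀ f r r' → r' N.≤ r → (∀ q → InBox r' q → f q ≡ true) →
                    boxSize r' N.≤ countTrue f (boxPoints r)
count-≥-inner-box f r r' r'≤r all-f = subst (boxSize r' N.≤_) (sym (countTrue-boxPoints f r))
  (NP.≤-trans (sumBelow-≥ (λ t → sumBelow (cell (lo + t)) M) len len column)
              (sumBelow-window (λ i → sumBelow (cell i) M) lo len M fits))
  where
    lo : ℕ
    lo = r ∸ r'
    len : ℕ
    len = suc (2 * r')
    M : ℕ
    M = suc (2 * r)
    fits : lo + len N.≤ M
    fits = subst (λ z → lo + len N.≤ suc (2 * z)) (NP.m∸n+n≡m r'≤r)
      (NP.≤-trans (NP.m≤m+n (lo + len) lo) (NP.≤-reflexive (widen lo r')))
      where
        widen : ∀ lo r' → lo + suc (2 * r') + lo ≡ suc (2 * (lo + r'))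
        widen = solve-∀
    cell : ℕ → ℕ → ℕ
    cell i j = indicator (f (coord r i , coord r j))
    column : ∀ t → t N.< len → len N.≤ sumBelow (cell (lo + t)) M
    column t t<len = subst (N._≤ sumBelow (cell (lo + t)) M) (NP.*-identityʳ len)
      (NP.≤-trans (sumBelow-≥ (λ t' → cell (lo + t) (lo + t')) 1 len burnt)
                  (sumBelow-window (cell (lo + t)) lo len M fits))
      where
        burnt : ∀ t' → t' N.< len → 1 N.≤ cell (lo + t) (lo + t')
        burnt t' t'<len = subst (λ b → 1 N.≤ indicator b)
          (sym (all-f (coord r (lo + t) , coord r (lo + t')) (∣coord∣≤ r r' t r'≤r t<len , ∣coord∣≤ r r' t' r'≤r t'<len)))
          NP.≤-refl

ratio-close : ∀ b S .{{_ : N.NonZero S}} n₀ dm .(cp : Coprime (suc n₀) (suc dm)) →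
              b N.≤ S → (S ∸ b) * suc dm N.< suc n₀ * S →
              Q.∣ (+ b) Q./ S Q.- Q.1ℚ ∣ Q.< mkℚ +[1+ n₀ ] dm cp
ratio-close b (suc s₁) n₀ dm cp b≤S deficit = QP.toℚᵘ-cancel-< (UP.<-respˡ-≃ (UP.≃-sym as-ℚᵘ) (U.*<* cross))
  where
    S : ℕ
    S = suc s₁
    w : Q.ℚ
    w = (+ b) Q./ S Q.- Q.1ℚ
    as-ℚᵘ : Q.toℚᵘ Q.∣ w ∣ U.≃ U.∣ U.mkℚᵘ (+ b) s₁ U.+ U.- (U.mkℚᵘ (+ 1) 0) ∣
    as-ℚᵘ = UP.≃-trans (QP.toℚᵘ-homo-∣-∣ w) (UP.∣-∣-cong
              (UP.≃-trans (QP.toℚᵘ-homo-+ ((+ b) Q./ S) (Q.- Q.1ℚ))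
                (UP.+-cong (/-toℚᵘ (+ b) s₁) (QP.toℚᵘ-homo‿- Q.1ℚ))))
    simplify : ∀ (B S' : ℤ) → B Z.* + 1 Z.+ Z.- (+ 1) Z.* S' ≡ B Z.- S'
    simplify = ZR.solve-∀
    numerator : Z.∣ + b Z.* + 1 Z.+ Z.- (+ 1) Z.* + S ∣ ≡ S ∸ b
    numerator = trans (cong Z.∣_∣ (trans (simplify (+ b) (+ S)) (trans (ZP.m-n≡m⊖n b S) (ZP.⊖-≤ b≤S))))
                  (ZP.∣-i∣≡∣i∣ (+ (S ∸ b)))
    cross : + Z.∣ + b Z.* + 1 Z.+ Z.- (+ 1) Z.* + S ∣ Z.* + suc dm Z.< +[1+ n₀ ] Z.* + (S * 1)
    cross rewrite numerator = *<⇒+*+< {S ∸ b} {suc dm} {suc n₀} {S * 1}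
                                (subst (λ z → (S ∸ b) * suc dm N.< suc n₀ * z) (sym (NP.*-identityʳ S)) deficit)

density-from-deficit : ∀ a v → (∀ n → burnedCount a v n N.≤ boxSize (a n)) →
  (∀ M → ∃[ N ] ∀ n → N N.≤ n → (boxSize (a n) ∸ burnedCount a v n) * suc M N.< boxSize (a n)) →
  DensityOne a v
density-from-deficit a v bounded small (mkℚ +0 _ _) (Q.*<* (+<+ ()))
density-from-deficit a v bounded small (mkℚ -[1+ _ ] _ _) (Q.*<* ())
density-from-deficit a v bounded small (mkℚ +[1+ n₀ ] dm cp) _ with small dm
... | N , eventually = N , λ n N≤n → ratio-close (burnedCount a v n) (boxSize (a n)) n₀ dm cp (bounded n)
  (NP.<-≤-trans (eventually n N≤n) (NP.m≤m+n (boxSize (a n)) (n₀ * boxSize (a n))))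

phaseLength : ℕ → ℕ
phaseLength k = suc (4 * (3 * (k * k) + 3 * k) + 3)

phaseStart : ℕ → ℕ
phaseStart zero    = 0
phaseStart (suc k) = phaseStart k + phaseLength k

phaseStart-cube : ∀ k → phaseStart k ≡ 4 * (k * k * k)
phaseStart-cube zero    = refl
phaseStart-cube (suc k) = trans (cong (_+ phaseLength k) (phaseStart-cube k)) (next-cube k)
  where
    next-cube : ∀ k → 4 * (k * k * k) + (1 + (4 * (3 * (k * k) + 3 * k) + 3)) ≡ 4 * ((1 + k) * (1 + k) * (1 + k))
    next-cube = solve-∀

record Position (n : ℕ) : Set where
  field
    phase  : ℕ
    offset : ℕ
    at     : phaseStart phase + offset ≡ n
    within : offset N.< phaseLength phase

position : ∀ n → Position n
position zero    = record { phase = 0 ; offset = 0 ; at = refl ; within = s≤s z≤n }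
position (suc n) = tick (position n)
  where
    tick : Position n → Position (suc n)
    tick P with suc (Position.offset P) N.<? phaseLength (Position.phase P)
    ... | yes more = record { phase = k ; offset = suc t ; at = trans (NP.+-suc (phaseStart k) t) (cong suc at) ; within = more }
      where open Position P renaming (phase to k; offset to t)
    ... | no ¬more = record { phase = suc k ; offset = 0 ; within = s≤s z≤n
                            ; at = trans (NP.+-identityʳ _) (trans (cong (λ s → phaseStart k + s) (sym last)) (trans (NP.+-suc (phaseStart k) t) (cong suc at))) }
      where
        open Position P renaming (phase to k; offset to t)
        last : suc t ≡ phaseLength k
        last = NP.≤-antisym within (NP.≮⇒≥ ¬more)

phaseLength-mono : ∀ m e → phaseLength m N.≤ phaseLength (m + e)
phaseLength-mono m e = s≤s (NP.≤-trans (NP.m≤m+n (4 * (3 * (m * m) + 3 * m) + 3) _) (NP.≤-reflexive (sym (growth m e))))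
  where
    growth : ∀ m e → 4 * (3 * ((m + e) * (m + e)) + 3 * (m + e)) + 3
                   ≡ (4 * (3 * (m * m) + 3 * m) + 3) + 4 * (3 * (2 * m * e + e * e) + 3 * e)
    growth = solve-∀

phaseStart-lower : ∀ m e → phaseStart m + e * phaseLength m N.≤ phaseStart (m + e)
phaseStart-lower m zero = NP.≤-reflexive (trans (NP.+-identityʳ (phaseStart m)) (cong phaseStart (sym (NP.+-identityʳ m))))
phaseStart-lower m (suc e) = NP.≤-trans (NP.≤-reflexive (reorder (phaseStart m) (e * phaseLength m) (phaseLength m)))
  (NP.≤-trans (NP.+-mono-≤ (phaseStart-lower m e) (phaseLength-mono m e))
  (NP.≤-reflexive (cong phaseStart (sym (NP.+-suc m e)))))
  where
    reorder : ∀ s a b → s + (b + a) ≡ s + a + b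
    reorder = solve-∀

phaseStart-upper : ∀ m e → phaseStart (m + e) N.≤ phaseStart m + e * phaseLength (m + e)
phaseStart-upper m zero = NP.≤-reflexive (trans (cong phaseStart (NP.+-identityʳ m)) (sym (NP.+-identityʳ (phaseStart m))))
phaseStart-upper m (suc e) = begin
  phaseStart (m + suc e)                                  ≡⟨ cong phaseStart (NP.+-suc m e) ⟩
  phaseStart (m + e) + phaseLength (m + e)                ≤⟨ NP.+-monoˡ-≤ _ (phaseStart-upper m e) ⟩
  phaseStart m + e * phaseLength (m + e) + phaseLength (m + e)
    ≤⟨ NP.+-mono-≤ (NP.+-monoʳ-≤ (phaseStart m) (NP.*-monoʳ-≤ e longer)) longer ⟩
  phaseStart m + e * phaseLength (m + suc e) + phaseLength (m + suc e) ≡⟨ reorder (phaseStart m) _ _ ⟩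
  phaseStart m + suc e * phaseLength (m + suc e)          ∎
  where
    open NP.≤-Reasoning
    longer : phaseLength (m + e) N.≤ phaseLength (m + suc e)
    longer = subst (λ z → phaseLength (m + e) N.≤ phaseLength z) (trans (NP.+-comm (m + e) 1) (sym (NP.+-suc m e)))
               (phaseLength-mono (m + e) 1)
    reorder : ∀ s a b → s + a + b ≡ s + (b + a)
    reorder = solve-∀

phaseStart-mono : ∀ {m m'} → m N.≤ m' → phaseStart m N.≤ phaseStart m'
phaseStart-mono {m} {m'} m≤m' = subst (λ z → phaseStart m N.≤ phaseStart z) (NP.m+[n∸m]≡n m≤m')
  (NP.≤-trans (NP.m≤m+n (phaseStart m) _) (phaseStart-lower m (m' ∸ m)))

before-later-phase : ∀ {k k' t} → k N.< k' → t N.< phaseLength k → phaseStart k + t N.< phaseStart k'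
before-later-phase {k} k<k' t<len = NP.<-≤-trans (NP.+-monoʳ-< (phaseStart k) t<len) (phaseStart-mono k<k')

position-unique : ∀ {k t k' t'} → phaseStart k + t ≡ phaseStart k' + t' →
                  t N.< phaseLength k → t' N.< phaseLength k' → (k ≡ k') × (t ≡ t')
position-unique {k} {t} {k'} {t'} e t< t'< with NP.<-cmp k k'
... | tri< k<k' _ _ = ⊥-elim (NP.<⇒≱ (before-later-phase k<k' t<) (subst (phaseStart k' N.≤_) (sym e) (NP.m≤m+n _ t')))
... | tri> _ _ k'<k = ⊥-elim (NP.<⇒≱ (before-later-phase k'<k t'<) (subst (phaseStart k N.≤_) e (NP.m≤m+n _ t)))
... | tri≈ _ refl _ = refl , NP.+-cancelˡ-≡ (phaseStart k) t t' e

position-at : ∀ k t → t N.< phaseLength k →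
              (Position.phase (position (phaseStart k + t)) ≡ k) × (Position.offset (position (phaseStart k + t)) ≡ t)
position-at k t t< = position-unique (Position.at P) (Position.within P) t<
  where
    P : Position (phaseStart k + t)
    P = position (phaseStart k + t)

decode-index : ∀ j1 j2 s → j2 N.< suc s → ((j1 * suc s + j2) / suc s ≡ j1) × ((j1 * suc s + j2) % suc s ≡ j2)
decode-index j1 j2 s j2<s = quotient , remainder
  where
    remainder : (j1 * suc s + j2) % suc s ≡ j2
    remainder = trans (cong (_% suc s) (NP.+-comm (j1 * suc s) j2))
                  (trans (DM.[m+kn]%n≡m%n j2 j1 (suc s)) (DM.m<n⇒m%n≡m j2<s))
    quotient : (j1 * suc s + j2) / suc s ≡ j1
    quotient = begin
      (j1 * suc s + j2) / suc s         ≡⟨ DM.+-distrib-/-∣ˡ j2 (divides-refl j1) ⟩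
      j1 * suc s / suc s + j2 / suc s  ≡⟨ cong₂ _+_ (DM.m*n/n≡m j1 (suc s)) (DM.m<n⇒m/n≡0 j2<s) ⟩
      j1 + 0                           ≡⟨ NP.+-identityʳ j1 ⟩
      j1                               ∎
      where open ≡-Reasoning

lattice : ℕ → ℕ → ℕ → ℤ
lattice d k j = + (d * j) Z.- + (d * k)

lattice-above : ∀ d k q → lattice d k (k + q) ≡ + (d * q)
lattice-above d k q rewrite NP.*-distribˡ-+ d k q | ZP.pos-+ (d * k) (d * q) = cancel (+ (d * k)) (+ (d * q))
  where
    cancel : ∀ (A B : ℤ) → (A Z.+ B) Z.- A ≡ B
    cancel = ZR.solve-∀

lattice-below : ∀ d j q → lattice d (j + q) j ≡ Z.- + (d * q)
lattice-below d j q rewrite NP.*-distribˡ-+ d j q | ZP.pos-+ (d * j) (d * q) = cancel (+ (d * j)) (+ (d * q))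
  where
    cancel : ∀ (A B : ℤ) → A Z.- (A Z.+ B) ≡ Z.- B
    cancel = ZR.solve-∀

euclid : ∀ u d .{{_ : N.NonZero d}} → + u ≡ + (u % d) Z.+ + (d * (u / d))
euclid u d = trans (cong +_ (DM.m≡m%n+[m/n]*n u d))
  (trans (ZP.pos-+ (u % d) ((u / d) * d)) (cong (λ z → + (u % d) Z.+ + z) (NP.*-comm (u / d) d)))

-- Rounding |x| ≤ dk down to the lattice keeps the lattice index within [0, 2k].
quotient≤ : ∀ u d k .{{_ : N.NonZero d}} → u N.≤ d * k → u / d N.≤ k
quotient≤ u d k u≤dk = NP.≤-trans (DM./-monoˡ-≤ d u≤dk) (NP.≤-reflexive (trans (cong (_/ d) (NP.*-comm d k)) (DM.m*n/n≡m k d)))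

record LatticeApprox (d k : ℕ) (x : ℤ) : Set where
  field
    index    : ℕ
    in-range : index N.≤ 2 * k
    inner    : Z.∣ lattice d k index ∣ N.≤ Z.∣ x ∣
    near     : Z.∣ x Z.- lattice d k index ∣ N.< d

lattice-approx : ∀ d k x .{{_ : N.NonZero d}} → Z.∣ x ∣ N.≤ d * k → LatticeApprox d k x
lattice-approx d k (+ u) u≤dk = record { index = k + q ; in-range = j≤2k ; inner = at-most-u ; near = close }
  where
    q : ℕ
    q = u / d
    q≤k : q N.≤ k
    q≤k = quotient≤ u d k u≤dk
    j≤2k : k + q N.≤ 2 * k
    j≤2k = NP.≤-trans (NP.+-monoʳ-≤ k q≤k) (NP.≤-reflexive (cong (λ s → k + s) (sym (NP.+-identityʳ k))))
    at-most-u : Z.∣ lattice d k (k + q) ∣ N.≤ u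
    at-most-u rewrite lattice-above d k q = subst (N._≤ u) (NP.*-comm q d) (DM.m/n*n≤m u d)
    cancel : ∀ (R Q : ℤ) → (R Z.+ Q) Z.- Q ≡ R
    cancel = ZR.solve-∀
    offset : + u Z.- lattice d k (k + q) ≡ + (u % d)
    offset = trans (cong (λ z → + u Z.- z) (lattice-above d k q))
               (trans (cong (Z._- + (d * q)) (euclid u d)) (cancel (+ (u % d)) (+ (d * q))))
    close : Z.∣ + u Z.- lattice d k (k + q) ∣ N.< d
    close = subst (λ z → Z.∣ z ∣ N.< d) (sym offset) (DM.m%n<n u d)
lattice-approx d k -[1+ m ] u≤dk = record { index = k ∸ q ; in-range = j≤2k ; inner = at-most-u ; near = close }
  where
    u : ℕ
    u = suc m
    q : ℕ
    q = u / d
    q≤k : q N.≤ k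
    q≤k = quotient≤ u d k u≤dk
    j≤2k : k ∸ q N.≤ 2 * k
    j≤2k = NP.≤-trans (NP.m∸n≤m k q) (NP.≤-trans (NP.m≤m+n k k) (NP.≤-reflexive (cong (λ s → k + s) (sym (NP.+-identityʳ k)))))
    point : lattice d k (k ∸ q) ≡ Z.- + (d * q)
    point = subst (λ z → lattice d z (k ∸ q) ≡ Z.- + (d * q)) (NP.m∸n+n≡m q≤k) (lattice-below d (k ∸ q) q)
    at-most-u : Z.∣ lattice d k (k ∸ q) ∣ N.≤ u
    at-most-u rewrite point | ZP.∣-i∣≡∣i∣ (+ (d * q)) = subst (N._≤ u) (NP.*-comm q d) (DM.m/n*n≤m u d)
    cancel : ∀ (R Q : ℤ) → Z.- (R Z.+ Q) Z.- Z.- Q ≡ Z.- R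
    cancel = ZR.solve-∀
    offset : -[1+ m ] Z.- lattice d k (k ∸ q) ≡ Z.- + (u % d)
    offset = trans (cong (λ z → -[1+ m ] Z.- z) point)
               (trans (cong (λ z → Z.- z Z.- Z.- + (d * q)) (euclid u d)) (cancel (+ (u % d)) (+ (d * q))))
    close : Z.∣ -[1+ m ] Z.- lattice d k (k ∸ q) ∣ N.< d
    close = subst (λ z → Z.∣ z ∣ N.< d) (sym offset)
              (subst (N._< d) (sym (ZP.∣-i∣≡∣i∣ (+ (u % d)))) (DM.m%n<n u d))

ifInBox : ℕ → Point → Maybe Point
ifInBox r p with inBox r p
... | true  = just p
... | false = nothing

ifInBox-valid : ∀ r p q → ifInBox r p ≡ just q → inBox r q ≡ true
ifInBox-valid r p q e with inBox r p in p∈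
ifInBox-valid r p .p refl | true = p∈

ifInBox-hit : ∀ r p → inBox r p ≡ true → ifInBox r p ≡ just p
ifInBox-hit r p p∈ with inBox r p
... | true = refl

side : ℕ → ℕ
side k = suc (2 * k)

side²≤phaseLength : ∀ k → side k * side k N.≤ phaseLength k
side²≤phaseLength k = NP.≤-trans (NP.m≤m+n _ _) (NP.≤-reflexive (split k))
  where
    split : ∀ k → (1 + 2 * k) * (1 + 2 * k) + (8 * (k * k) + 8 * k + 3) ≡ 1 + (4 * (3 * (k * k) + 3 * k) + 3)
    split = solve-∀

index<side² : ∀ j1 j2 k → j1 N.≤ 2 * k → j2 N.≤ 2 * k → j1 * side k + j2 N.< side k * side k
index<side² j1 j2 k j1≤ j2≤ = NP.<-≤-trans (NP.+-monoʳ-< (j1 * side k) (s≤s j2≤))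
  (NP.≤-trans (NP.≤-reflexive (NP.+-comm (j1 * side k) (side k))) (NP.*-monoˡ-≤ (side k) (s≤s j1≤)))

module Strategy (a : ℕ → ℕ) (K : ℕ) where

  -- Net spacing in phase k: large enough that the net [-spacing·k, spacing·k] covers
  -- G at the start of the phase (radius ≤ 4Kk³), small enough that two spacings
  -- elapse within 2K phases.
  spacing : ℕ → ℕ
  spacing k = suc (8 * K * (k * k))

  netPoint : ℕ → ℕ → ℕ → Point
  netPoint k j1 j2 = (lattice (spacing k) k j1 , lattice (spacing k) k j2)

  activate : ℕ → ℕ → ℕ → Maybe Point
  activate i k t = ifInBox (a i) (netPoint k (t / side k) (t % side k))

  activation : ℕ → Maybe Point
  activation i = activate i (Position.phase (position i)) (Position.offset (position i))

  activation-valid : ValidActivation a activation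
  activation-valid i p = ifInBox-valid (a i) _ p

  activation-at : ∀ k j1 j2 → j1 N.≤ 2 * k → j2 N.≤ 2 * k →
                  let i = phaseStart k + (j1 * side k + j2) in
                  inBox (a i) (netPoint k j1 j2) ≡ true → activation i ≡ just (netPoint k j1 j2)
  activation-at k j1 j2 j1≤ j2≤ p∈ = begin
    activate i (Position.phase (position i)) (Position.offset (position i))
      ≡⟨ cong₂ (activate i) (proj₁ positioned) (proj₂ positioned) ⟩
    ifInBox (a i) (netPoint k (t / side k) (t % side k))
      ≡⟨ cong₂ (λ u w → ifInBox (a i) (netPoint k u w)) (proj₁ decoded) (proj₂ decoded) ⟩
    ifInBox (a i) (netPoint k j1 j2)
      ≡⟨ ifInBox-hit (a i) _ p∈ ⟩
    just (netPoint k j1 j2) ∎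
    where
      open ≡-Reasoning
      t : ℕ
      t = j1 * side k + j2
      i : ℕ
      i = phaseStart k + t
      positioned : (Position.phase (position i) ≡ k) × (Position.offset (position i) ≡ t)
      positioned = position-at k t (NP.<-≤-trans (index<side² j1 j2 k j1≤ j2≤) (side²≤phaseLength k))
      decoded : (t / side k ≡ j1) × (t % side k ≡ j2)
      decoded = decode-index j1 j2 (2 * k) (s≤s j2≤)

phaseOf : ℕ → ℕ
phaseOf n = Position.phase (position n)

phaseStart≤ : ∀ n → phaseStart (phaseOf n) N.≤ n
phaseStart≤ n = subst (phaseStart (phaseOf n) N.≤_) (Position.at (position n)) (NP.m≤m+n _ _)

<phaseStart-next : ∀ n → n N.< phaseStart (suc (phaseOf n))
<phaseStart-next n = subst (N._< phaseStart (suc (phaseOf n))) (Position.at P) (NP.+-monoʳ-< _ (Position.within P))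
  where P = position n

phaseOf-≥ : ∀ k0 n → phaseStart k0 N.≤ n → k0 N.≤ phaseOf n
phaseOf-≥ k0 n start≤n with k0 N.≤? phaseOf n
... | yes k0≤ = k0≤
... | no k0≰ = ⊥-elim (NP.<⇒≱ (<phaseStart-next n) (NP.≤-trans (phaseStart-mono (NP.≰⇒> k0≰)) start≤n))

square-gap : ∀ u V w M → u N.≤ V → V N.≤ u + w → 2 * w * M N.< V → (V * V ∸ u * u) * M N.< V * V
square-gap u zero w M _ _ ()
square-gap u (suc V₀) w M u≤V V≤u+w 2wM<V = NP.≤-<-trans frame≤ (NP.*-monoʳ-< V 2wM<V)
  where
    V : ℕ
    V = suc V₀
    e : ℕ
    e = V ∸ u
    u+e≡V : u + e ≡ V
    u+e≡V = NP.m+[n∸m]≡n u≤V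
    square : ∀ u e → (u + e) * (u + e) ≡ u * u + e * (u + (u + e))
    square = solve-∀
    difference : V * V ∸ u * u ≡ e * (u + V)
    difference = trans (cong (λ z → z * z ∸ u * u) (sym u+e≡V))
      (trans (cong (_∸ u * u) (square u e)) (trans (NP.m+n∸m≡n (u * u) _) (cong (λ z → e * (u + z)) u+e≡V)))
    e≤w : e N.≤ w
    e≤w = NP.≤-trans (NP.∸-monoˡ-≤ u V≤u+w) (NP.≤-reflexive (NP.m+n∸m≡n u w))
    regroup : ∀ w V M → w * (V + V) * M ≡ V * (2 * w * M)
    regroup = solve-∀
    frame≤ : (V * V ∸ u * u) * M N.≤ V * (2 * w * M)
    frame≤ = NP.≤-trans (NP.≤-reflexive (cong (_* M) difference))
      (NP.≤-trans (NP.*-monoˡ-≤ M (NP.*-mono-≤ e≤w (NP.+-monoˡ-≤ V u≤V))) (NP.≤-reflexive (regroup w V M)))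

phaseLength-next≤ : ∀ k → 1 N.≤ k → phaseLength (suc k) N.≤ 76 * (k * k)
phaseLength-next≤ (suc k₀) _ = NP.≤-trans (NP.m≤m+n _ _) (NP.≤-reflexive (expand k₀))
  where
    expand : ∀ k₀ → 1 + (4 * (3 * ((2 + k₀) * (2 + k₀)) + 3 * (2 + k₀)) + 3) + (64 * (k₀ * k₀) + 92 * k₀)
                    ≡ 76 * ((1 + k₀) * (1 + k₀))
    expand = solve-∀

lag-small : ∀ K E M k → 38 * (K * E * M) N.≤ k → 2 * (2 * (K * (E * (76 * (k * k))))) * M N.≤ 8 * (k * k * k)
lag-small K E M k k≥ = begin
  2 * (2 * (K * (E * (76 * (k * k))))) * M  ≡⟨ factor K E M k ⟩
  8 * (38 * (K * E * M) * (k * k))          ≤⟨ NP.*-monoʳ-≤ 8 (NP.*-monoˡ-≤ (k * k) k≥) ⟩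
  8 * (k * (k * k))                         ≡⟨ cube k ⟩
  8 * (k * k * k)                           ∎
  where
    open NP.≤-Reasoning
    factor : ∀ K E M k → 2 * (2 * (K * (E * (76 * (k * k))))) * M ≡ 8 * (38 * (K * E * M) * (k * k))
    factor = solve-∀
    cube : ∀ k → 8 * (k * (k * k)) ≡ 8 * (k * k * k)
    cube = solve-∀

module Covering (a : ℕ → ℕ) (S : SlopeBounds a) where
  open SlopeBounds S
  open Strategy a K public
  open Fire a activation public

  start-radius≤net : ∀ k → a (phaseStart k) N.≤ spacing k * k
  start-radius≤net k = begin
    a (phaseStart k)                                ≤⟨ a≤K* (phaseStart k) ⟩
    K * phaseStart k                                ≡⟨ cong (K *_) (phaseStart-cube k) ⟩
    K * (4 * (k * k * k))                           ≤⟨ NP.m≤m+n _ _ ⟩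
    K * (4 * (k * k * k)) + (K * (4 * (k * k * k)) + k) ≡⟨ sym (expand K k) ⟩
    spacing k * k                                   ∎
    where
      open NP.≤-Reasoning
      expand : ∀ K k → (1 + 8 * K * (k * k)) * k ≡ K * (4 * (k * k * k)) + (K * (4 * (k * k * k)) + k)
      expand = solve-∀

  record NetHit (k : ℕ) (q : Point) : Set where
    field
      time      : ℕ
      point     : Point
      early     : time N.≤ phaseStart (suc k)
      activated : activation time ≡ just point
      inside    : InBox (a time) point
      close     : dist₁ point q N.≤ spacing k + spacing k

  net-hit : ∀ k q → InBox (a (phaseStart k)) q → NetHit k q
  net-hit k (x , y) (hx , hy) = record
    { time = i ; point = P ; early = i≤next ; inside = P∈ ; close = P-near
    ; activated = activation-at k j1 j2 (in-range ax) (in-range ay) (inBox-intro (a i) P P∈) }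
    where
      open LatticeApprox using (index; in-range; inner)
      ax : LatticeApprox (spacing k) k x
      ax = lattice-approx (spacing k) k x (NP.≤-trans hx (start-radius≤net k))
      ay : LatticeApprox (spacing k) k y
      ay = lattice-approx (spacing k) k y (NP.≤-trans hy (start-radius≤net k))
      j1 j2 t i : ℕ
      j1 = index ax
      j2 = index ay
      t = j1 * side k + j2
      i = phaseStart k + t
      P : Point
      P = netPoint k j1 j2
      start≤i : a (phaseStart k) N.≤ a i
      start≤i = NP.≤-trans (NP.m≤m+n _ t) (grows (phaseStart k) t)
      P∈ : InBox (a i) P
      P∈ = NP.≤-trans (inner ax) (NP.≤-trans hx start≤i) , NP.≤-trans (inner ay) (NP.≤-trans hy start≤i)
      i≤next : i N.≤ phaseStart (suc k)
      i≤next = NP.+-monoʳ-≤ (phaseStart k)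
        (NP.<⇒≤ (NP.<-≤-trans (index<side² j1 j2 k (in-range ax) (in-range ay)) (side²≤phaseLength k)))
      P-near : dist₁ P (x , y) N.≤ spacing k + spacing k
      P-near = NP.+-mono-≤ (NP.<⇒≤ (LatticeApprox.near ax)) (NP.<⇒≤ (LatticeApprox.near ay))

  spacing-fits : ∀ k → spacing k + spacing k N.≤ 2 * K * phaseLength k
  spacing-fits k with K | 1≤K
  ... | suc K₀ | _ = NP.≤-trans (NP.m≤m+n _ _) (NP.≤-reflexive (sym (expand K₀ k)))
    where
      expand : ∀ K₀ k → 2 * (1 + K₀) * (1 + (4 * (3 * (k * k) + 3 * k) + 3)) ≡
               (1 + 8 * (1 + K₀) * (k * k)) + (1 + 8 * (1 + K₀) * (k * k)) + (8 * (1 + K₀) * (k * k) + 24 * (1 + K₀) * k + 8 * K₀ + 6)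
      expand = solve-∀

  -- Phases a grid of a phase start needs before it is entirely burnt.
  delay : ℕ
  delay = suc (2 * K)

  core-burnt : ∀ n → delay N.≤ phaseOf n → ∀ q → InBox (a (phaseStart (phaseOf n ∸ delay))) q → B n q ≡ true
  core-burnt n delay≤k q q∈ =
    subst (λ m → B m q ≡ true) (NP.m+[n∸m]≡n (NP.≤-trans (NP.m≤m+n i _) i+2d≤n))
      (ball-burns grows i p activated inside (n ∸ i) q
        (NP.≤-trans close (subst (N._≤ n ∸ i) (NP.m+n∸m≡n i _) (NP.∸-monoˡ-≤ i i+2d≤n))))
    where
      k' : ℕ
      k' = phaseOf n ∸ delay
      open NetHit (net-hit k' q q∈) renaming (time to i; point to p)
      phases : suc k' + 2 * K ≡ phaseOf n
      phases = trans (sym (NP.+-suc k' (2 * K))) (NP.m∸n+n≡m delay≤k)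
      i+2d≤n : i + (spacing k' + spacing k') N.≤ n
      i+2d≤n = begin
        i + (spacing k' + spacing k')
          ≤⟨ NP.+-mono-≤ early (NP.≤-trans (spacing-fits k') (NP.*-monoʳ-≤ (2 * K) (phaseLength-mono k' 1))) ⟩
        phaseStart (suc k') + 2 * K * phaseLength (k' + 1)
          ≡⟨ cong (λ z → phaseStart (suc k') + 2 * K * phaseLength z) (NP.+-comm k' 1) ⟩
        phaseStart (suc k') + 2 * K * phaseLength (suc k')
          ≤⟨ phaseStart-lower (suc k') (2 * K) ⟩
        phaseStart (suc k' + 2 * K)  ≡⟨ cong phaseStart phases ⟩
        phaseStart (phaseOf n)       ≤⟨ phaseStart≤ n ⟩
        n                            ∎
        where open NP.≤-Reasoning

  growth-since-core : ∀ n → delay N.≤ phaseOf n →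
    a n N.≤ a (phaseStart (phaseOf n ∸ delay)) + K * (suc delay * (76 * (phaseOf n * phaseOf n)))
  growth-since-core n delay≤k = subst (λ m → a m N.≤ a start + K * (suc delay * (76 * (k * k)))) (NP.m+[n∸m]≡n start≤n)
    (NP.≤-trans (lipschitz start (n ∸ start)) (NP.+-monoʳ-≤ (a start) (NP.*-monoʳ-≤ K elapsed≤)))
    where
      k : ℕ
      k = phaseOf n
      k' : ℕ
      k' = k ∸ delay
      start : ℕ
      start = phaseStart k'
      start≤n : start N.≤ n
      start≤n = NP.≤-trans (phaseStart-mono (NP.m∸n≤m k delay)) (phaseStart≤ n)
      phases : k' + suc delay ≡ suc k
      phases = trans (NP.+-suc k' delay) (cong suc (NP.m∸n+n≡m delay≤k))
      next≤ : phaseStart (suc k) N.≤ start + suc delay * phaseLength (suc k)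
      next≤ = subst (λ z → phaseStart z N.≤ start + suc delay * phaseLength z) phases (phaseStart-upper k' (suc delay))
      elapsed≤ : n ∸ start N.≤ suc delay * (76 * (k * k))
      elapsed≤ = NP.≤-trans (NP.∸-monoˡ-≤ start (NP.<⇒≤ (NP.<-≤-trans (<phaseStart-next n) next≤)))
        (NP.≤-trans (NP.≤-reflexive (NP.m+n∸m≡n start _))
          (NP.*-monoʳ-≤ (suc delay) (phaseLength-next≤ k (NP.≤-trans (s≤s z≤n) delay≤k))))

  cube≤radius : ∀ n → 4 * (phaseOf n * phaseOf n * phaseOf n) N.≤ a n
  cube≤radius n = NP.≤-trans (NP.≤-reflexive (sym (phaseStart-cube (phaseOf n)))) (NP.≤-trans (phaseStart≤ n) (n≤a n))

  core≤radius : ∀ n → a (phaseStart (phaseOf n ∸ delay)) N.≤ a n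
  core≤radius n = subst (λ m → a (phaseStart (phaseOf n ∸ delay)) N.≤ a m) (NP.m+[n∸m]≡n start≤n)
    (NP.≤-trans (NP.m≤m+n _ _) (grows (phaseStart (phaseOf n ∸ delay)) (n ∸ phaseStart (phaseOf n ∸ delay))))
    where
      start≤n : phaseStart (phaseOf n ∸ delay) N.≤ n
      start≤n = NP.≤-trans (phaseStart-mono (NP.m∸n≤m (phaseOf n) delay)) (phaseStart≤ n)

  deficit-small : ∀ M → ∃[ N ] ∀ n → N N.≤ n →
                  (boxSize (a n) ∸ burnedCount a activation n) * suc M N.< boxSize (a n)
  deficit-small M = phaseStart k₀ , λ n start≤n → estimate n (phaseOf-≥ k₀ n start≤n)
    where
      k₀ : ℕ
      k₀ = 38 * (K * suc delay * suc M) + delay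
      estimate : ∀ n → k₀ N.≤ phaseOf n → (boxSize (a n) ∸ burnedCount a activation n) * suc M N.< boxSize (a n)
      estimate n k₀≤k = NP.≤-<-trans (NP.*-monoˡ-≤ (suc M) (NP.∸-monoʳ-≤ (boxSize A) core-counted))
        (square-gap (suc (2 * r)) (suc (2 * A)) (2 * W) (suc M) (s≤s (NP.*-monoʳ-≤ 2 (core≤radius n)))
          (s≤s (NP.≤-trans (NP.*-monoʳ-≤ 2 (growth-since-core n delay≤k)) (NP.≤-reflexive (NP.*-distribˡ-+ 2 r W))))
          (s≤s (NP.≤-trans (lag-small K (suc delay) (suc M) k (NP.≤-trans (NP.m≤m+n _ delay) k₀≤k))
                           (NP.≤-trans (NP.≤-reflexive (double (phaseOf n))) (NP.*-monoʳ-≤ 2 (cube≤radius n))))))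
        where
          k : ℕ
          k = phaseOf n
          A : ℕ
          A = a n
          r : ℕ
          r = a (phaseStart (k ∸ delay))
          W : ℕ
          W = K * (suc delay * (76 * (k * k)))
          delay≤k : delay N.≤ k
          delay≤k = NP.≤-trans (NP.m≤n+m delay _) k₀≤k
          core-counted : boxSize r N.≤ burnedCount a activation n
          core-counted = count-≥-inner-box (B n) A r (core≤radius n) (core-burnt n delay≤k)
          double : ∀ k → 8 * (k * k * k) ≡ 2 * (4 * (k * k * k))
          double = solve-∀

theorem9 : (c : ℝ) → OneLeq c → (a : ℕ → ℕ) → IsCeilMul c a →
    ∃[ v ] (ValidActivation a v × DensityOne a v)
theorem9 c 1≤c a ceil =
  activation , activation-valid ,
  density-from-deficit a activation (λ n → count-≤-boxSize (B n) (a n)) deficit-small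
  where open Covering a (ceiling-slopes c 1≤c a ceil)
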